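{- Let $\alpha$ and $\beta$ be positive integers and let $M$ be a square-free positive integer with $5 \nmid M$. Then $n = 5^{\alpha} M^{2\beta}$ is not an odd perfect number.
   Context: A positive integer $n$ is perfect if $\sigma(n) = 2n$, where $\sigma(n)$ denotes the sum of all positive divisors of $n$. -}

module Defs where

open import Data.Nat using (ℕ; zero; suc; _+_; _*_; _^_; _≡ᵇ_)
open import Data.Nat.Divisibility using (_∣_; _∣?_)
open import Data.List using (List; filter; upTo; map)
open import Data.Nat.ListAction using (sum)
open import Relation.Binary.PropositionalEquality using (_≡_)
open import Relation.Nullary using (¬_)

divisors : ℕ → List ℕ
divisors n = filter (_∣? n) (map suc (upTo n))

σ : ℕ → ℕ
σ n = sum (divisors n)

Perfect : ℕ → Set
Perfect n = σ n ≡ 2 * n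

Odd : ℕ → Set
Odd n = ¬ (2 ∣ n)

SquareFree : ℕ → Set
SquareFree m = ∀ d → d * d ∣ m → d ≡ 1

-- Write n = 5^α M^k with k = 2β.  Since σ is multiplicative and σ(q^k) = 1 + q + ⋯ + q^k for a prime q,
-- perfection says σ(5^α) · σ(M^k) = 2n, and for square-free M a prime divides σ(M^k) only if it
-- divides 1 + q + ⋯ + q^k for some prime q ∣ M.  Whether a small modulus divides 1 + q + ⋯ + q^k depends
-- only on q and k modulo a short period, which is checked by evaluation.  As k is even, σ(M^k) is odd,
-- so 2 ∣ σ(5^α); hence α is odd, 3 ∣ σ(5^α) and 3 ∣ M.  As 5 ∤ σ(5^α), some 1 + q + ⋯ + q^k is divisible
-- by 5, which forces 5 ∣ k + 1; then 11² = σ(3⁴) divides σ(3^k), so 11 ∣ M.  If 3 ∣ k + 1, also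
-- 13 = σ(3²) ∣ M and 5·3²·11·13 ∣ n.  Otherwise 3 ∤ σ(M^k), so 9 ∣ σ(5^α), which forces 3 ∣ α + 1 and
-- 31 = σ(5²) ∣ M; with k ≥ 4 this gives 5·3⁴·11·31 ∣ n.  Either divisor is abundant, hence so is n.

module Submission where

open import Data.Fin using (Fin; toℕ; fromℕ<)
open import Data.Fin.Properties using (all?; toℕ-fromℕ<)
open import Data.List using (List; []; _∷_; map; filter; upTo; _++_; cartesianProduct)
open import Data.List.Properties using (map-++; map-∘)
open import Data.List.Membership.Propositional using (_∈_)
open import Data.List.Membership.Propositional.Properties
open import Data.List.Membership.Propositional.Properties.WithK using (unique∧set⇒bag)
open import Data.List.Relation.Binary.BagAndSetEquality using (_∼[_]_; set; ∼bag⇒↭)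
open import Data.List.Relation.Binary.Subset.Propositional using (_⊆_)
open import Data.List.Relation.Unary.All as All using (All; _∷_)
import Data.List.Relation.Unary.All.Properties as All
open import Data.List.Relation.Unary.AllPairs using ([]; _∷_)
open import Data.List.Relation.Unary.Any using (here; there)
open import Data.List.Relation.Unary.Unique.Propositional using (Unique)
import Data.List.Relation.Unary.Unique.Propositional.Properties as Unique
open import Data.Nat using (ℕ; zero; suc; _+_; _*_; _^_; _/_; _∸_; _≤_; _<_; _<?_; z<s; s≤s; _≟_;
                            NonZero; >-nonZero; nonTrivial⇒n>1)
open import Data.Nat.Properties
open import Data.Nat.Coprimality as Coprime using (Coprime; coprime?; coprime-divisor; coprime-/gcd)
open import Data.Nat.Divisibility
open import Data.Nat.DivMod using (_%_; m*[n/m]≡n; %-distribˡ-+; %-distribˡ-*; m≡m%n+[m/n]*n; m%n<n)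
open import Data.Nat.GCD using (gcd; gcd[m,n]∣m; gcd[m,n]∣n)
open import Data.Nat.GeneralisedArithmetic using (fold; fold-+)
open import Data.Nat.LCM using (lcm-least)
open import Data.Nat.ListAction using (sum; product)
open import Data.Nat.ListAction.Properties using (sum-++; sum-↭)
open import Data.Nat.Primality
  using (Prime; prime?; prime[2]; prime⇒irreducible; prime⇒nonZero; prime⇒nonTrivial; euclidsLemma; productOfPrimes≥1)
open import Data.Nat.Primality.Factorisation using (PrimeFactorisation; factorise)
open import Data.List.Membership.DecPropositional _≟_ using (_∈?_)
open import Data.Product using (_×_; _,_; proj₁; proj₂; uncurry; ∃₂; ∃-syntax)
open import Data.Sum using (_⊎_; inj₁; inj₂)
open import Function using (_∘_; mk⇔)
open import Relation.Binary.PropositionalEquality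
open import Relation.Nullary using (¬_; yes; no; contradiction)
open import Relation.Nullary.Decidable as Dec using (Dec; True; toWitness; _×-dec_; _→-dec_; from-yes; from-no)

open import Defs

prime>1 : ∀ {p} → Prime p → 1 < p
prime>1 {p} p-prime = nonTrivial⇒n>1 p {{prime⇒nonTrivial p-prime}}

prime[3] : Prime 3
prime[3] = from-yes (prime? 3)

prime[5] : Prime 5
prime[5] = from-yes (prime? 5)

divisor-pos : ∀ {d n} → 0 < n → d ∣ n → 0 < d
divisor-pos {zero}  {suc n} _ 0∣n with () ← 0∣⇒≡0 0∣n
divisor-pos {suc d} _ _ = z<s

^-distribʳ-* : ∀ m n k → (m * n) ^ k ≡ m ^ k * n ^ k
^-distribʳ-* m n zero    = refl
^-distribʳ-* m n (suc k) = trans (cong (m * n *_) (^-distribʳ-* m n k)) ([m*n]*[o*p]≡[m*o]*[n*p] m n (m ^ k) (n ^ k))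

^-monoˡ-∣ : ∀ {d m} j → d ∣ m → d ^ j ∣ m ^ j
^-monoˡ-∣ zero    _   = ∣-refl
^-monoˡ-∣ (suc j) d∣m = *-pres-∣ d∣m (^-monoˡ-∣ j d∣m)

^-monoʳ-∣ : ∀ m {i j} → i ≤ j → m ^ i ∣ m ^ j
^-monoʳ-∣ m {i} {j} i≤j = divides (m ^ (j ∸ i)) (begin
  m ^ j                ≡⟨ cong (m ^_) (m+[n∸m]≡n i≤j) ⟨
  m ^ (i + (j ∸ i))    ≡⟨ ^-distribˡ-+-* m i (j ∸ i) ⟩
  m ^ i * m ^ (j ∸ i)  ≡⟨ *-comm (m ^ i) _ ⟩
  m ^ (j ∸ i) * m ^ i  ∎)
  where open ≡-Reasoning

prime∣^⇒∣ : ∀ {p m} k → Prime p → p ∣ m ^ k → p ∣ m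
prime∣^⇒∣ zero    p-prime p∣1 = contradiction (∣1⇒≡1 p∣1) (>⇒≢ (prime>1 p-prime))
prime∣^⇒∣ {m = m} (suc k) p-prime p∣m^k+1 with euclidsLemma m (m ^ k) p-prime p∣m^k+1
... | inj₁ p∣m   = p∣m
... | inj₂ p∣m^k = prime∣^⇒∣ k p-prime p∣m^k

prime∤⇒coprime : ∀ {p d} → Prime p → ¬ p ∣ d → Coprime p d
prime∤⇒coprime p-prime p∤d (i∣p , i∣d) with prime⇒irreducible p-prime i∣p
... | inj₁ i≡1  = i≡1
... | inj₂ refl = contradiction i∣d p∤d

coprime∧∣^⇒≡1 : ∀ {d q} k → Coprime d q → d ∣ q ^ k → d ≡ 1
coprime∧∣^⇒≡1 zero    _       d∣1     = ∣1⇒≡1 d∣1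
coprime∧∣^⇒≡1 (suc k) coprime d∣q^k+1 = coprime∧∣^⇒≡1 k coprime (coprime-divisor coprime d∣q^k+1)

-- Sums over duplicate-free lists

sum-unique-∼set : ∀ {xs ys : List ℕ} → Unique xs → Unique ys → xs ∼[ set ] ys → sum xs ≡ sum ys
sum-unique-∼set xs! ys! xs∼ys = sum-↭ (∼bag⇒↭ (unique∧set⇒bag xs! ys! xs∼ys))

sum-mono-⊆ : ∀ {xs ys : List ℕ} → Unique xs → Unique ys → xs ⊆ ys → sum xs ≤ sum ys
sum-mono-⊆ {xs} {ys} xs! ys! xs⊆ys = begin
  sum xs                ≤⟨ m≤m+n (sum xs) (sum rest) ⟩
  sum xs + sum rest     ≡⟨ sum-++ xs rest ⟨
  sum (xs ++ rest)      ≡⟨ sum-unique-∼set xs++rest! ys! (mk⇔ to from) ⟩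
  sum ys                ∎
  where
  open ≤-Reasoning
  new? : ∀ x → Dec (¬ x ∈ xs)
  new? = Dec.¬? ∘ (_∈? xs)
  rest : List ℕ
  rest = filter new? ys
  xs++rest! : Unique (xs ++ rest)
  xs++rest! = Unique.++⁺ xs! (Unique.filter⁺ _ ys!)
    λ (x∈xs , x∈rest) → proj₂ (∈-filter⁻ new? {xs = ys} x∈rest) x∈xs
  to : ∀ {x} → x ∈ xs ++ rest → x ∈ ys
  to x∈ with ∈-++⁻ xs x∈
  ... | inj₁ x∈xs   = xs⊆ys x∈xs
  ... | inj₂ x∈rest = proj₁ (∈-filter⁻ new? {xs = ys} x∈rest)
  from : ∀ {x} → x ∈ ys → x ∈ xs ++ rest
  from {x} x∈ys with x ∈? xs
  ... | yes x∈xs = ∈-++⁺ˡ x∈xs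
  ... | no  x∉xs = ∈-++⁺ʳ xs (∈-filter⁺ new? x∈ys x∉xs)

map⁺-injectiveOn : ∀ {A B : Set} {f : A → B} {xs} →
                   (∀ {x y} → x ∈ xs → y ∈ xs → f x ≡ f y → x ≡ y) → Unique xs → Unique (map f xs)
map⁺-injectiveOn {xs = []}     _   []         = []
map⁺-injectiveOn {xs = x ∷ xs} inj (x∉ ∷ xs!) =
  All.map⁺ (All.tabulate λ y∈xs fx≡fy → All.lookup x∉ y∈xs (inj (here refl) (there y∈xs) fx≡fy))
  ∷ map⁺-injectiveOn (λ x∈ y∈ → inj (there x∈) (there y∈)) xs!

sum-map-*ˡ : ∀ c xs → sum (map (c *_) xs) ≡ c * sum xs
sum-map-*ˡ c []       = sym (*-zeroʳ c)
sum-map-*ˡ c (x ∷ xs) = begin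
  c * x + sum (map (c *_) xs) ≡⟨ cong (c * x +_) (sum-map-*ˡ c xs) ⟩
  c * x + c * sum xs          ≡⟨ *-distribˡ-+ c x (sum xs) ⟨
  c * (x + sum xs)            ∎
  where open ≡-Reasoning

sum-cartesianProduct-* : ∀ xs ys → sum (map (uncurry _*_) (cartesianProduct xs ys)) ≡ sum xs * sum ys
sum-cartesianProduct-* []       ys = refl
sum-cartesianProduct-* (x ∷ xs) ys = begin
  sum (map (uncurry _*_) (map (x ,_) ys ++ cartesianProduct xs ys))
    ≡⟨ cong sum (map-++ (uncurry _*_) (map (x ,_) ys) (cartesianProduct xs ys)) ⟩
  sum (map (uncurry _*_) (map (x ,_) ys) ++ map (uncurry _*_) (cartesianProduct xs ys))
    ≡⟨ sum-++ (map (uncurry _*_) (map (x ,_) ys)) _ ⟩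
  sum (map (uncurry _*_) (map (x ,_) ys)) + sum (map (uncurry _*_) (cartesianProduct xs ys))
    ≡⟨ cong₂ _+_ (cong sum (sym (map-∘ ys))) (sum-cartesianProduct-* xs ys) ⟩
  sum (map (x *_) ys) + sum xs * sum ys
    ≡⟨ cong (_+ sum xs * sum ys) (sum-map-*ˡ x ys) ⟩
  x * sum ys + sum xs * sum ys
    ≡⟨ *-distribʳ-+ (sum ys) x (sum xs) ⟨
  (x + sum xs) * sum ys ∎
  where open ≡-Reasoning

-- The divisor sum

∈-divisors⁺ : ∀ {d n} → 0 < n → d ∣ n → d ∈ divisors n
∈-divisors⁺ {zero}  {suc n} _ 0∣n with () ← 0∣⇒≡0 0∣n
∈-divisors⁺ {suc d} {suc n} _ d∣n = ∈-filter⁺ (_∣? suc n) (∈-map⁺ suc (∈-upTo⁺ (∣⇒≤ d∣n))) d∣n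

∈-divisors⁻ : ∀ {d} n → d ∈ divisors n → d ∣ n
∈-divisors⁻ n d∈ = proj₂ (∈-filter⁻ (_∣? n) {xs = map suc (upTo n)} d∈)

divisors-unique : ∀ n → Unique (divisors n)
divisors-unique n = Unique.filter⁺ (_∣? n) (Unique.map⁺ suc-injective (Unique.upTo⁺ n))

∣*-coprime-split : ∀ {a b d} → 0 < a → Coprime a b → d ∣ a * b → ∃₂ λ g h → g ∣ a × h ∣ b × d ≡ g * h
∣*-coprime-split {a} {b} {d} a>0 coprime d∣ab = g , d / g , g∣a , d/g∣b , sym (m*[n/m]≡n g∣d)
  where
  g : ℕ
  g = gcd d a
  g∣d : g ∣ d
  g∣d = gcd[m,n]∣m d a
  g∣a : g ∣ a
  g∣a = gcd[m,n]∣n d a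
  instance
    g≢0 : NonZero g
    g≢0 = >-nonZero (divisor-pos a>0 g∣a)
  d/g∣b : d / g ∣ b
  d/g∣b = coprime-divisor (coprime-/gcd d a) (*-cancelˡ-∣ g (subst₂ _∣_
    (sym (m*[n/m]≡n g∣d)) (trans (cong (_* b) (sym (m*[n/m]≡n g∣a))) (*-assoc g (a / g) b)) d∣ab))

σ-*-coprime : ∀ {a b} → 0 < a → 0 < b → Coprime a b → σ (a * b) ≡ σ a * σ b
σ-*-coprime {a} {b} a>0 b>0 coprime = begin
  σ (a * b)                     ≡⟨ sum-unique-∼set (divisors-unique (a * b)) products! (mk⇔ to from) ⟩
  sum (map (uncurry _*_) pairs) ≡⟨ sum-cartesianProduct-* (divisors a) (divisors b) ⟩
  σ a * σ b                     ∎
  where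
  open ≡-Reasoning
  pairs : List (ℕ × ℕ)
  pairs = cartesianProduct (divisors a) (divisors b)
  to : ∀ {x} → x ∈ divisors (a * b) → x ∈ map (uncurry _*_) pairs
  to x∈ with g , h , g∣a , h∣b , refl ← ∣*-coprime-split a>0 coprime (∈-divisors⁻ (a * b) x∈) =
    ∈-map⁺ (uncurry _*_) (∈-cartesianProduct⁺ (∈-divisors⁺ a>0 g∣a) (∈-divisors⁺ b>0 h∣b))
  from : ∀ {x} → x ∈ map (uncurry _*_) pairs → x ∈ divisors (a * b)
  from x∈ with (d , e) , de∈ , refl ← ∈-map⁻ (uncurry _*_) x∈
    with d∈ , e∈ ← ∈-cartesianProduct⁻ (divisors a) (divisors b) de∈ =
    ∈-divisors⁺ (*-mono-≤ a>0 b>0) (*-pres-∣ (∈-divisors⁻ a d∈) (∈-divisors⁻ b e∈))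
  injective : ∀ {u v} → u ∈ pairs → v ∈ pairs → uncurry _*_ u ≡ uncurry _*_ v → u ≡ v
  injective {d , e} {d′ , e′} de∈ de′∈ de≡d′e′
    with d∈ , e∈ ← ∈-cartesianProduct⁻ (divisors a) (divisors b) de∈
       | d′∈ , e′∈ ← ∈-cartesianProduct⁻ (divisors a) (divisors b) de′∈ = cong₂ _,_ d≡d′ e≡e′
    where
    divides-other : ∀ {d e d′ e′} → d ∈ divisors a → e′ ∈ divisors b → d * e ≡ d′ * e′ → d ∣ d′
    divides-other {d} {e} {d′} {e′} d∈ e′∈ eq =
      coprime-divisor (λ (i∣d , i∣e′) → coprime (∣-trans i∣d (∈-divisors⁻ a d∈) , ∣-trans i∣e′ (∈-divisors⁻ b e′∈)))
        (subst (d ∣_) (trans eq (*-comm d′ e′)) (m∣m*n e))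
    d≡d′ : d ≡ d′
    d≡d′ = ∣-antisym (divides-other d∈ e′∈ de≡d′e′) (divides-other d′∈ e∈ (sym de≡d′e′))
    e≡e′ : e ≡ e′
    e≡e′ = *-cancelˡ-≡ e e′ d {{>-nonZero (divisor-pos a>0 (∈-divisors⁻ a d∈))}}
             (trans de≡d′e′ (cong (_* e′) (sym d≡d′)))
  products! : Unique (map (uncurry _*_) pairs)
  products! = map⁺-injectiveOn injective (Unique.cartesianProduct⁺ (divisors-unique a) (divisors-unique b))

σ*≤σ[*] : ∀ {n c} → 0 < n → 0 < c → σ n * c ≤ σ (n * c)
σ*≤σ[*] {n} {c} n>0 c>0 = begin
  σ n * c                          ≡⟨ *-comm (σ n) c ⟩
  c * σ n                          ≡⟨ sum-map-*ˡ c (divisors n) ⟨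
  sum (map (c *_) (divisors n))    ≤⟨ sum-mono-⊆ multiples! (divisors-unique (n * c)) multiples⊆ ⟩
  σ (n * c)                        ∎
  where
  open ≤-Reasoning
  multiples! : Unique (map (c *_) (divisors n))
  multiples! = Unique.map⁺ (*-cancelˡ-≡ _ _ c {{>-nonZero c>0}}) (divisors-unique n)
  multiples⊆ : map (c *_) (divisors n) ⊆ divisors (n * c)
  multiples⊆ x∈ with d , d∈ , refl ← ∈-map⁻ (c *_) x∈ =
    ∈-divisors⁺ (*-mono-≤ n>0 c>0) (subst (c * d ∣_) (*-comm c n) (*-monoʳ-∣ c (∈-divisors⁻ n d∈)))

abundant-divisor⇒¬perfect : ∀ {d n} → 0 < n → d ∣ n → 2 * d < σ d → ¬ Perfect n
abundant-divisor⇒¬perfect {d} {n} n>0 (divides c refl) 2d<σd perfect = <-irrefl refl (begin-strict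
  2 * (c * d)   ≡⟨ cong (2 *_) (*-comm c d) ⟩
  2 * (d * c)   ≡⟨ *-assoc 2 d c ⟨
  2 * d * c     <⟨ *-monoˡ-< c {{>-nonZero c>0}} 2d<σd ⟩
  σ d * c       ≤⟨ σ*≤σ[*] d>0 c>0 ⟩
  σ (d * c)     ≡⟨ cong σ (*-comm d c) ⟩
  σ (c * d)     ≡⟨ perfect ⟩
  2 * (c * d)   ∎)
  where
  open ≤-Reasoning
  c>0 : 0 < c
  c>0 = divisor-pos n>0 (m∣m*n {c} d)
  d>0 : 0 < d
  d>0 = divisor-pos n>0 (n∣m*n c {d})

-- Prime powers

geom : ℕ → ℕ → ℕ
geom q zero    = 1
geom q (suc k) = 1 + q * geom q k

powers : ℕ → ℕ → List ℕ
powers q zero    = 1 ∷ []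
powers q (suc k) = 1 ∷ map (q *_) (powers q k)

sum-powers : ∀ q k → sum (powers q k) ≡ geom q k
sum-powers q zero    = refl
sum-powers q (suc k) = cong suc (trans (sum-map-*ˡ q (powers q k)) (cong (q *_) (sum-powers q k)))

∈-powers⇒∣^ : ∀ {q x} k → x ∈ powers q k → x ∣ q ^ k
∈-powers⇒∣^ zero    (here refl) = ∣-refl
∈-powers⇒∣^ (suc k) (here refl) = 1∣ _
∈-powers⇒∣^ {q} (suc k) (there x∈) with y , y∈ , refl ← ∈-map⁻ (q *_) x∈ = *-monoʳ-∣ q (∈-powers⇒∣^ k y∈)

∈-powers⇒≡1⊎∣ : ∀ {q x} k → x ∈ powers q k → x ≡ 1 ⊎ q ∣ x
∈-powers⇒≡1⊎∣ zero    (here refl) = inj₁ refl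
∈-powers⇒≡1⊎∣ (suc k) (here refl) = inj₁ refl
∈-powers⇒≡1⊎∣ {q} (suc k) (there x∈) with y , _ , refl ← ∈-map⁻ (q *_) x∈ = inj₂ (m∣m*n y)

powers-unique : ∀ {q} k → 1 < q → Unique (powers q k)
powers-unique zero        _   = All.[] ∷ []
powers-unique {q} (suc k) q>1 =
  All.tabulate (λ x∈ 1≡x → multiple≢1 x∈ (sym 1≡x))
  ∷ Unique.map⁺ (*-cancelˡ-≡ _ _ q {{>-nonZero (<-trans z<s q>1)}}) (powers-unique k q>1)
  where
  multiple≢1 : ∀ {x} → x ∈ map (q *_) (powers q k) → x ≢ 1
  multiple≢1 x∈ qy≡1 with y , _ , refl ← ∈-map⁻ (q *_) x∈ = <⇒≢ q>1 (sym (m*n≡1⇒m≡1 q y qy≡1))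

∣prime^⇒∈-powers : ∀ {p d} k → Prime p → d ∣ p ^ k → d ∈ powers p k
∣prime^⇒∈-powers zero _ d∣1 rewrite ∣1⇒≡1 d∣1 = here refl
∣prime^⇒∈-powers {p} {d} (suc k) p-prime d∣p^k+1 with p ∣? d
... | no p∤d rewrite coprime∧∣^⇒≡1 (suc k) (Coprime.sym (prime∤⇒coprime p-prime p∤d)) d∣p^k+1 = here refl
... | yes (divides e refl) = there (subst (_∈ map (p *_) (powers p k)) (*-comm p e)
        (∈-map⁺ (p *_) (∣prime^⇒∈-powers k p-prime
          (*-cancelˡ-∣ p {{prime⇒nonZero p-prime}} (subst (_∣ p * p ^ k) (*-comm e p) d∣p^k+1)))))

coprime-prime^ : ∀ {p c} k → Prime p → ¬ p ∣ c → Coprime (p ^ k) c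
coprime-prime^ k p-prime p∤c (i∣p^k , i∣c) with ∈-powers⇒≡1⊎∣ k (∣prime^⇒∈-powers k p-prime i∣p^k)
... | inj₁ i≡1 = i≡1
... | inj₂ p∣i = contradiction (∣-trans p∣i i∣c) p∤c

σ-prime^ : ∀ {p} k → Prime p → σ (p ^ k) ≡ geom p k
σ-prime^ {p} k p-prime = begin
  σ (p ^ k)          ≡⟨ sum-unique-∼set (divisors-unique (p ^ k)) (powers-unique k (prime>1 p-prime))
                          (mk⇔ (∣prime^⇒∈-powers k p-prime ∘ ∈-divisors⁻ (p ^ k))
                               (∈-divisors⁺ (m^n>0 p {{prime⇒nonZero p-prime}} k) ∘ ∈-powers⇒∣^ k)) ⟩
  sum (powers p k)   ≡⟨ sum-powers p k ⟩
  geom p k           ∎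
  where open ≡-Reasoning

σ-prime^-* : ∀ {p c} k → Prime p → ¬ p ∣ c → 0 < c → σ (p ^ k * c) ≡ geom p k * σ c
σ-prime^-* {p} {c} k p-prime p∤c c>0 = begin
  σ (p ^ k * c)      ≡⟨ σ-*-coprime (m^n>0 p {{prime⇒nonZero p-prime}} k) c>0 (coprime-prime^ k p-prime p∤c) ⟩
  σ (p ^ k) * σ c    ≡⟨ cong (_* σ c) (σ-prime^ k p-prime) ⟩
  geom p k * σ c     ∎
  where open ≡-Reasoning

-- Square-free numbers

squarefree⇒prime∤cofactor : ∀ {p m} → Prime p → SquareFree (p * m) → ¬ p ∣ m
squarefree⇒prime∤cofactor {p} p-prime sf p∣m = >⇒≢ (prime>1 p-prime) (sf p (*-monoʳ-∣ p p∣m))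

σ-squarefree^-split : ∀ {p m} k → Prime p → SquareFree (p * m) → 0 < m →
                      σ ((p * m) ^ k) ≡ geom p k * σ (m ^ k)
σ-squarefree^-split {p} {m} k p-prime sf m>0 = trans (cong σ (^-distribʳ-* p m k))
  (σ-prime^-* k p-prime (squarefree⇒prime∤cofactor p-prime sf ∘ prime∣^⇒∣ k p-prime) (m^n>0 m {{>-nonZero m>0}} k))

prime∣σ[product^]⇒ : ∀ {r} k ps → Prime r → All Prime ps → SquareFree (product ps) →
                     r ∣ σ (product ps ^ k) → ∃[ q ] q ∣ product ps × r ∣ geom q k
prime∣σ[product^]⇒ {r} k [] r-prime _ _ r∣σ[1]
  rewrite ^-zeroˡ k = contradiction (∣1⇒≡1 r∣σ[1]) (>⇒≢ (prime>1 r-prime))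
prime∣σ[product^]⇒ {r} k (q ∷ qs) r-prime (q-prime ∷ qs-prime) sf r∣σ
  with euclidsLemma (geom q k) (σ (product qs ^ k)) r-prime
         (subst (r ∣_) (σ-squarefree^-split k q-prime sf (productOfPrimes≥1 qs-prime)) r∣σ)
... | inj₁ r∣geom = q , m∣m*n (product qs) , r∣geom
... | inj₂ r∣σ′ with q′ , q′∣ , r∣geom ← prime∣σ[product^]⇒ k qs r-prime qs-prime
                                           (λ d dd∣ → sf d (∣n⇒∣m*n q dd∣)) r∣σ′
  = q′ , ∣n⇒∣m*n q q′∣ , r∣geom

prime∣σ[squarefree^]⇒ : ∀ {r m} k → Prime r → 0 < m → SquareFree m →
                        r ∣ σ (m ^ k) → ∃[ q ] q ∣ m × r ∣ geom q k
prime∣σ[squarefree^]⇒ {r} {suc m} k r-prime _ sf r∣σ =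
  subst (λ n → ∃[ q ] q ∣ n × r ∣ geom q k) (sym isFactorisation)
    (prime∣σ[product^]⇒ k factors r-prime factorsPrime (subst SquareFree isFactorisation sf)
      (subst (λ n → r ∣ σ (n ^ k)) isFactorisation r∣σ))
  where open PrimeFactorisation (factorise (suc m))

geom∣σ[squarefree^] : ∀ {p m} k → Prime p → 0 < m → SquareFree m → p ∣ m → geom p k ∣ σ (m ^ k)
geom∣σ[squarefree^] {p} k p-prime m>0 sf (divides c refl) rewrite *-comm c p =
  subst (geom p k ∣_) (sym (σ-squarefree^-split k p-prime sf (divisor-pos m>0 (n∣m*n p)))) (m∣m*n _)

-- Divisibility of geometric sums

geom-+ : ∀ q d k → geom q (suc d + k) ≡ geom q d + q ^ suc d * geom q k
geom-+ q zero    k = cong (λ x → 1 + x * geom q k) (sym (*-identityʳ q))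
geom-+ q (suc d) k = cong suc (begin
  q * geom q (suc d + k)                         ≡⟨ cong (q *_) (geom-+ q d k) ⟩
  q * (geom q d + q ^ suc d * geom q k)          ≡⟨ *-distribˡ-+ q (geom q d) _ ⟩
  q * geom q d + q * (q ^ suc d * geom q k)      ≡⟨ cong (q * geom q d +_) (*-assoc q (q ^ suc d) _) ⟨
  q * geom q d + q ^ suc (suc d) * geom q k      ∎)
  where open ≡-Reasoning

geom-∣ : ∀ q d k → suc d ∣ suc k → geom q d ∣ geom q k
geom-∣ q d k (divides (suc j) sk≡) = subst (λ n → geom q d ∣ geom q n) (sym (suc-injective sk≡)) (blocks j)
  where
  blocks : ∀ j → geom q d ∣ geom q (d + j * suc d)
  blocks zero    = ∣-reflexive (cong (geom q) (sym (+-identityʳ d)))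
  blocks (suc j) = subst (λ n → geom q d ∣ geom q n) (sym (+-suc d (d + j * suc d)))
    (subst (geom q d ∣_) (sym (geom-+ q d (d + j * suc d))) (∣m∣n⇒∣m+n ∣-refl (∣n⇒∣m*n (q ^ suc d) (blocks j))))

∣base∧∣geom⇒∣1 : ∀ {d q} k → d ∣ q → d ∣ geom q k → d ∣ 1
∣base∧∣geom⇒∣1 zero    _   d∣1 = d∣1
∣base∧∣geom⇒∣1 {d} {q} (suc k) d∣q d∣geom =
  ∣m+n∣m⇒∣n (subst (d ∣_) (+-comm 1 (q * geom q k)) d∣geom) (∣m⇒∣m*n (geom q k) d∣q)

geomMod : (m : ℕ) .{{_ : NonZero m}} → ℕ → ℕ → ℕ
geomMod m a = fold (1 % m) (λ x → (1 + a * x) % m)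

geom-% : ∀ q k m .{{_ : NonZero m}} → geom q k % m ≡ geomMod m (q % m) k
geom-% q zero    m = refl
geom-% q (suc k) m = begin
  (1 + q * geom q k) % m                       ≡⟨ %-distribˡ-+ 1 (q * geom q k) m ⟩
  (1 % m + q * geom q k % m) % m               ≡⟨ cong (λ x → (1 % m + x) % m) product≡ ⟩
  (1 % m + q % m * geomMod m (q % m) k % m) % m ≡⟨ %-distribˡ-+ 1 (q % m * geomMod m (q % m) k) m ⟨
  (1 + q % m * geomMod m (q % m) k) % m        ∎
  where
  open ≡-Reasoning
  product≡ : q * geom q k % m ≡ q % m * geomMod m (q % m) k % m
  product≡ = trans (%-distribˡ-* q (geom q k) m) (cong (λ x → q % m * x % m) (geom-% q k m))

∣geom⇒geomMod≡0 : ∀ q k m .{{_ : NonZero m}} → m ∣ geom q k → geomMod m (q % m) k ≡ 0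
∣geom⇒geomMod≡0 q k m m∣geom = trans (sym (geom-% q k m)) (n∣m⇒m%n≡0 _ m m∣geom)

geomMod-periodic : ∀ {m} .{{_ : NonZero m}} {a P} → geomMod m a P ≡ geomMod m a 0 →
                   ∀ i j → geomMod m a (i + j * P) ≡ geomMod m a i
geomMod-periodic {m} {a} {P} period i j = trans (fold-+ _ _ i) (cong (λ z → fold z _ i) (returns j))
  where
  returns : ∀ j → geomMod m a (j * P) ≡ geomMod m a 0
  returns zero    = refl
  returns (suc j) = trans (fold-+ _ _ P) (trans (cong (λ z → fold z _ P) (returns j)) period)

PeriodicZeros : (m : ℕ) .{{_ : NonZero m}} (a P D : ℕ) → Set
PeriodicZeros m a P D = geomMod m a P ≡ geomMod m a 0 × D ∣ P ×
                        (∀ (i : Fin P) → geomMod m a (toℕ i) ≡ 0 → D ∣ suc (toℕ i))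

periodicZeros? : ∀ m .{{_ : NonZero m}} a P D → Dec (PeriodicZeros m a P D)
periodicZeros? m a P D = geomMod m a P ≟ geomMod m a 0 ×-dec D ∣? P ×-dec
                         all? (λ i → geomMod m a (toℕ i) ≟ 0 →-dec D ∣? suc (toℕ i))

geomMod≡0⇒∣suc : ∀ m .{{_ : NonZero m}} a P .{{_ : NonZero P}} D → {True (periodicZeros? m a P D)} →
                 ∀ k → geomMod m a k ≡ 0 → D ∣ suc k
geomMod≡0⇒∣suc m a P D {certified} k gk≡0 with period , D∣P , zeros ← toWitness certified =
  subst (λ n → D ∣ suc n) (sym k≡) (∣m∣n⇒∣m+n D∣1+k%P (∣n⇒∣m*n (k / P) D∣P))
  where
  k≡ : k ≡ k % P + k / P * P
  k≡ = m≡m%n+[m/n]*n k P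
  i : Fin P
  i = fromℕ< (m%n<n k P)
  g[i]≡0 : geomMod m a (toℕ i) ≡ 0
  g[i]≡0 = begin
    geomMod m a (toℕ i)              ≡⟨ cong (geomMod m a) (toℕ-fromℕ< (m%n<n k P)) ⟩
    geomMod m a (k % P)              ≡⟨ geomMod-periodic {a = a} period (k % P) (k / P) ⟨
    geomMod m a (k % P + k / P * P)  ≡⟨ cong (geomMod m a) k≡ ⟨
    geomMod m a k                    ≡⟨ gk≡0 ⟩
    0                                ∎
    where open ≡-Reasoning
  D∣1+k%P : D ∣ suc (k % P)
  D∣1+k%P = subst (λ n → D ∣ suc n) (toℕ-fromℕ< (m%n<n k P)) (zeros i g[i]≡0)

2∣geom⇒2∣suc : ∀ q k → 2 ∣ geom q k → 2 ∣ suc k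
2∣geom⇒2∣suc q k 2∣geom = residue (q % 2) (m%n<n q 2) (∣geom⇒geomMod≡0 q k 2 2∣geom)
  where
  residue : ∀ a → a < 2 → geomMod 2 a k ≡ 0 → 2 ∣ suc k
  residue 0 _ = geomMod≡0⇒∣suc 2 0 2 2 k
  residue 1 _ = geomMod≡0⇒∣suc 2 1 2 2 k
  residue (suc (suc _)) (s≤s (s≤s ()))

3∣geom⇒ : ∀ q k → 3 ∣ geom q k → 3 ∣ suc k ⊎ 2 ∣ suc k
3∣geom⇒ q k 3∣geom = residue (q % 3) (m%n<n q 3) (∣geom⇒geomMod≡0 q k 3 3∣geom)
  where
  residue : ∀ a → a < 3 → geomMod 3 a k ≡ 0 → 3 ∣ suc k ⊎ 2 ∣ suc k
  residue 0 _ = inj₁ ∘ geomMod≡0⇒∣suc 3 0 3 3 k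
  residue 1 _ = inj₁ ∘ geomMod≡0⇒∣suc 3 1 3 3 k
  residue 2 _ = inj₂ ∘ geomMod≡0⇒∣suc 3 2 2 2 k
  residue (suc (suc (suc _))) (s≤s (s≤s (s≤s ())))

5∣geom⇒ : ∀ q k → 5 ∣ geom q k → 5 ∣ suc k ⊎ 2 ∣ suc k
5∣geom⇒ q k 5∣geom = residue (q % 5) (m%n<n q 5) (∣geom⇒geomMod≡0 q k 5 5∣geom)
  where
  residue : ∀ a → a < 5 → geomMod 5 a k ≡ 0 → 5 ∣ suc k ⊎ 2 ∣ suc k
  residue 0 _ = inj₁ ∘ geomMod≡0⇒∣suc 5 0 5 5 k
  residue 1 _ = inj₁ ∘ geomMod≡0⇒∣suc 5 1 5 5 k
  residue 2 _ = inj₂ ∘ geomMod≡0⇒∣suc 5 2 4 2 k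
  residue 3 _ = inj₂ ∘ geomMod≡0⇒∣suc 5 3 4 2 k
  residue 4 _ = inj₂ ∘ geomMod≡0⇒∣suc 5 4 2 2 k
  residue (suc (suc (suc (suc (suc _))))) (s≤s (s≤s (s≤s (s≤s (s≤s ())))))

9∣geom[5]⇒3∣suc : ∀ k → 9 ∣ geom 5 k → 3 ∣ suc k
9∣geom[5]⇒3∣suc k 9∣geom = geomMod≡0⇒∣suc 9 5 6 3 k (∣geom⇒geomMod≡0 5 k 9 9∣geom)

-- Perfect numbers of the form 5^α M^(2β)

module _ {α β M : ℕ} (α>0 : 0 < α) (β>0 : 0 < β) (M>0 : 0 < M) (sf : SquareFree M) (5∤M : ¬ 5 ∣ M)
         (perfect : Perfect (5 ^ α * M ^ (2 * β))) where

  private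
    k n : ℕ
    k = 2 * β
    n = 5 ^ α * M ^ k

  2≤k : 2 ≤ k
  2≤k = *-monoʳ-≤ 2 β>0

  2∤1+k : ¬ 2 ∣ suc k
  2∤1+k 2∣1+k = from-no (2 ∣? 1) (∣m+n∣m⇒∣n (subst (2 ∣_) (+-comm 1 k) 2∣1+k) (m∣m*n β))

  geom5α*σ[M^k]≡2n : geom 5 α * σ (M ^ k) ≡ 2 * n
  geom5α*σ[M^k]≡2n = trans (sym (σ-prime^-* α prime[5] (5∤M ∘ prime∣^⇒∣ k prime[5]) M^k>0)) perfect
    where
    M^k>0 : 0 < M ^ k
    M^k>0 = m^n>0 M {{>-nonZero M>0}} k

  ∣n⇒∣geom5α*σ : ∀ {d} → d ∣ n → d ∣ geom 5 α * σ (M ^ k)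
  ∣n⇒∣geom5α*σ {d} d∣n = subst (d ∣_) (sym geom5α*σ[M^k]≡2n) (∣n⇒∣m*n 2 d∣n)

  prime∣geom5α*σ⇒∣M : ∀ {p} → Prime p → ¬ p ∣ 2 → ¬ p ∣ 5 → p ∣ geom 5 α * σ (M ^ k) → p ∣ M
  prime∣geom5α*σ⇒∣M {p} p-prime p∤2 p∤5 p∣
    with euclidsLemma 2 n p-prime (subst (p ∣_) geom5α*σ[M^k]≡2n p∣)
  ... | inj₁ p∣2 = contradiction p∣2 p∤2
  ... | inj₂ p∣n with euclidsLemma (5 ^ α) (M ^ k) p-prime p∣n
  ...   | inj₁ p∣5^α = contradiction (prime∣^⇒∣ α p-prime p∣5^α) p∤5
  ...   | inj₂ p∣M^k = prime∣^⇒∣ k p-prime p∣M^k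

  2∤σ[M^k] : ¬ 2 ∣ σ (M ^ k)
  2∤σ[M^k] 2∣σ with q , _ , 2∣geom ← prime∣σ[squarefree^]⇒ k prime[2] M>0 sf 2∣σ =
    2∤1+k (2∣geom⇒2∣suc q k 2∣geom)

  3∣M : 3 ∣ M
  3∣M = prime∣geom5α*σ⇒∣M prime[3] (from-no (3 ∣? 2)) (from-no (3 ∣? 5))
          (∣m⇒∣m*n (σ (M ^ k)) (∣-trans (divides 2 refl) (geom-∣ 5 1 α 2∣1+α)))
    where
    2∣geom5α : 2 ∣ geom 5 α
    2∣geom5α with euclidsLemma (geom 5 α) (σ (M ^ k)) prime[2] (subst (2 ∣_) (sym geom5α*σ[M^k]≡2n) (m∣m*n n))
    ... | inj₁ 2∣geom = 2∣geom
    ... | inj₂ 2∣σ    = contradiction 2∣σ 2∤σ[M^k]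
    2∣1+α : 2 ∣ suc α
    2∣1+α = 2∣geom⇒2∣suc 5 α 2∣geom5α

  5∣5^α : 5 ∣ 5 ^ α
  5∣5^α = ^-monoʳ-∣ 5 α>0

  5∣n : 5 ∣ n
  5∣n = ∣m⇒∣m*n (M ^ k) 5∣5^α

  5∣1+k : 5 ∣ suc k
  5∣1+k with euclidsLemma (geom 5 α) (σ (M ^ k)) prime[5] (∣n⇒∣geom5α*σ 5∣n)
  ... | inj₁ 5∣geom = contradiction (∣base∧∣geom⇒∣1 α ∣-refl 5∣geom) (from-no (5 ∣? 1))
  ... | inj₂ 5∣σ with q , _ , 5∣geom ← prime∣σ[squarefree^]⇒ k prime[5] M>0 sf 5∣σ
                 with 5∣geom⇒ q k 5∣geom
  ...   | inj₁ 5∣1+k = 5∣1+k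
  ...   | inj₂ 2∣1+k = contradiction 2∣1+k 2∤1+k

  geom3k∣σ[M^k] : geom 3 k ∣ σ (M ^ k)
  geom3k∣σ[M^k] = geom∣σ[squarefree^] k prime[3] M>0 sf 3∣M

  11∣M : 11 ∣ M
  11∣M = prime∣geom5α*σ⇒∣M (from-yes (prime? 11)) (from-no (11 ∣? 2)) (from-no (11 ∣? 5))
           (∣n⇒∣m*n (geom 5 α) (∣-trans (divides 11 refl) (∣-trans (geom-∣ 3 4 k 5∣1+k) geom3k∣σ[M^k])))

  13∣M : 3 ∣ suc k → 13 ∣ M
  13∣M 3∣1+k = prime∣geom5α*σ⇒∣M (from-yes (prime? 13)) (from-no (13 ∣? 2)) (from-no (13 ∣? 5))
                 (∣n⇒∣m*n (geom 5 α) (∣-trans (geom-∣ 3 2 k 3∣1+k) geom3k∣σ[M^k]))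

  31∣M : ¬ 3 ∣ suc k → 31 ∣ M
  31∣M 3∤1+k = prime∣geom5α*σ⇒∣M (from-yes (prime? 31)) (from-no (31 ∣? 2)) (from-no (31 ∣? 5))
                 (∣m⇒∣m*n (σ (M ^ k)) (geom-∣ 5 2 α 3∣1+α))
    where
    3∤σ[M^k] : ¬ 3 ∣ σ (M ^ k)
    3∤σ[M^k] 3∣σ with q , _ , 3∣geom ← prime∣σ[squarefree^]⇒ k prime[3] M>0 sf 3∣σ
                 with 3∣geom⇒ q k 3∣geom
    ... | inj₁ 3∣1+k = 3∤1+k 3∣1+k
    ... | inj₂ 2∣1+k = 2∤1+k 2∣1+k
    9∣n : 9 ∣ n
    9∣n = ∣n⇒∣m*n (5 ^ α) (∣-trans (^-monoˡ-∣ 2 3∣M) (^-monoʳ-∣ M 2≤k))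
    9∣geom5α : 9 ∣ geom 5 α
    9∣geom5α = coprime-divisor (coprime-prime^ 2 prime[3] 3∤σ[M^k])
                 (subst (9 ∣_) (*-comm (geom 5 α) _) (∣n⇒∣geom5α*σ 9∣n))
    3∣1+α : 3 ∣ suc α
    3∣1+α = 9∣geom[5]⇒3∣suc α 9∣geom5α

  -- The witness 81 * 1705 lets σ split by multiplicativity, since evaluating σ 138105 directly is far
  -- too slow; a with on the decision is also too slow to check, hence the Dec argument.
  abundant-divisor : Dec (3 ∣ suc k) → ∃[ d ] d ∣ n × 2 * d < σ d
  abundant-divisor (yes 3∣1+k) =
    6435 , *-pres-∣ {5} {5 ^ α} {1287} {M ^ k} 5∣5^α 1287∣M^k , from-yes (2 * 6435 <? σ 6435)
    where
    1287∣M^k : 1287 ∣ M ^ k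
    1287∣M^k = ∣-trans (divides 143 refl)
      (∣-trans (^-monoˡ-∣ 2 (lcm-least (lcm-least 3∣M 11∣M) (13∣M 3∣1+k))) (^-monoʳ-∣ M 2≤k))
  abundant-divisor (no 3∤1+k) =
    81 * 1705 , *-pres-∣ {5} {5 ^ α} {27621} {M ^ k} 5∣5^α 27621∣M^k , abundant
    where
    4≤k : 4 ≤ k
    4≤k = ≤-pred (∣⇒≤ 5∣1+k)
    27621∣M^k : 27621 ∣ M ^ k
    27621∣M^k = ∣-trans (divides 39651821 refl)
      (∣-trans (^-monoˡ-∣ 4 (lcm-least (lcm-least 3∣M 11∣M) (31∣M 3∤1+k))) (^-monoʳ-∣ M 4≤k))
    abundant : 2 * (81 * 1705) < σ (81 * 1705)
    abundant = subst (2 * (81 * 1705) <_) (sym (σ-*-coprime {81} {1705} z<s z<s (from-yes (coprime? 81 1705))))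
                 (from-yes (2 * (81 * 1705) <? σ 81 * σ 1705))

theorem1p2 : (α β M : ℕ) → 0 < α → 0 < β → 0 < M → SquareFree M → ¬ (5 ∣ M) →
    ¬ (Odd (5 ^ α * M ^ (2 * β)) × Perfect (5 ^ α * M ^ (2 * β)))
theorem1p2 α β M α>0 β>0 M>0 sf 5∤M (_ , perfect)
  with d , d∣n , d-abundant ← abundant-divisor α>0 β>0 M>0 sf 5∤M perfect (3 ∣? suc (2 * β)) =
  abundant-divisor⇒¬perfect n>0 d∣n d-abundant perfect
  where
  n>0 : 0 < 5 ^ α * M ^ (2 * β)
  n>0 = *-mono-≤ (m^n>0 5 α) (m^n>0 M {{>-nonZero M>0}} (2 * β))
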